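{- Let $j$ be an odd integer and $q\ge 2$. Then, as polynomials in $x$, $$\prod_{i=0}^{2^q-1}(ix-i+j)\equiv\prod_{i=2^q}^{2^{q+1}-1}(ix-i+j)\pmod{2^{q+1}}.$$ -}

module Defs where

open import Data.Nat using (ℕ; zero; suc)
import Data.Nat as ℕ
open import Data.Integer using (ℤ; +_; _+_; _*_; _-_; 0ℤ; 1ℤ)
open import Data.Integer.Divisibility using (_∣_)
open import Data.Product using (Σ)
open import Relation.Binary.PropositionalEquality using (_≡_)
open import Data.List using (List; []; _∷_; map; foldr)

-- Polynomials in x with integer coefficients, as coefficient lists
-- (constant coefficient first). Trailing zeros are allowed; equality
-- up to trailing zeros is handled by `coeff`.
Poly : Set
Poly = List ℤ

coeff : Poly → ℕ → ℤ
coeff []       _       = 0ℤ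
coeff (a ∷ p)  zero    = a
coeff (a ∷ p)  (suc k) = coeff p k

_⊕_ : Poly → Poly → Poly
[]      ⊕ q       = q
(a ∷ p) ⊕ []      = a ∷ p
(a ∷ p) ⊕ (b ∷ q) = (a + b) ∷ (p ⊕ q)

scale : ℤ → Poly → Poly
scale c = map (c *_)

_⊗_ : Poly → Poly → Poly
[]      ⊗ q = []
(a ∷ p) ⊗ q = scale a q ⊕ (0ℤ ∷ (p ⊗ q))

one : Poly
one = 1ℤ ∷ []

prodFrom : (ℕ → Poly) → ℕ → ℕ → Poly
prodFrom f a zero      = one
prodFrom f a (suc len) = f a ⊗ prodFrom f (suc a) len

linFactor : ℤ → ℕ → Poly
linFactor j i = (j - + i) ∷ (+ i) ∷ []

_≡_[modPoly_] : Poly → Poly → ℤ → Set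
p ≡ q [modPoly m ] = ∀ (k : ℕ) → m ∣ (coeff p k - coeff q k)

Odd : ℤ → Set
Odd j = Σ ℤ (λ k → j ≡ (+ 2) * k + 1ℤ)

-- Write F i = (j - i) + i x and N = 2 ^ q. Since F (i + N) = F i + N (x - 1), expanding gives
-- ∏ F (N + i) = ∏ F i + N D for an integer polynomial D, so it suffices that D is even.
-- Modulo 2, D obeys the recursion of the derivative of ∏ (F i + ε (x - 1)) at ε = 0, and,
-- j being odd, F i is 1 for even i and x for odd i. Passing four consecutive factors thus
-- multiplies D by x² and adds every other term twice, so D ≡ 0 modulo 2 once 4 divides N,
-- that is once q ≥ 2.
module Submission where

open import Defs

-- An anonymous module keeps the integer operators out of the scope of the theorem statement.
module _ where
  open import Data.Nat as ℕ using (ℕ; zero; suc)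
  open import Data.Nat.Properties using (^-distribˡ-+-*; *-assoc; *-comm)
  open import Data.Nat.Divisibility using (m∣m*n)
  open import Data.Integer using (ℤ; +_; _+_; _*_; _-_; -_; 0ℤ; 1ℤ)
  open import Data.Integer.Properties
    using (+-identityˡ; +-identityʳ; *-identityˡ; *-zeroʳ; +-inverseʳ; pos-+; pos-*)
  open import Data.Integer.Divisibility.Signed
    using (_∣_; divides; ∣-refl; ∣ᵤ⇒∣; ∣⇒∣ᵤ; ∣m∣n⇒∣m+n; ∣m∣n⇒∣m-n; ∣m⇒∣-m; ∣m⇒∣m*n; *-monoʳ-∣)
  open import Data.Integer.Tactic.RingSolver using (solve-∀)
  open import Data.List using ([]; _∷_)
  open import Data.Product using (_,_)
  open import Level using (0ℓ)
  open import Relation.Binary.Bundles using (Setoid)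
  open import Relation.Binary.PropositionalEquality
    using (_≡_; _≗_; refl; sym; trans; cong; cong₂; subst; module ≡-Reasoning)

  Seq : Set
  Seq = ℕ → ℤ

  infixr 8 x·_
  infixr 7 _•_
  infixl 6 _+ˢ_ _-ˢ_

  0ˢ : Seq
  0ˢ _ = 0ℤ

  x·_ : Seq → Seq
  (x· s) zero    = 0ℤ
  (x· s) (suc k) = s k

  _+ˢ_ : Seq → Seq → Seq
  (s +ˢ t) k = s k + t k

  _-ˢ_ : Seq → Seq → Seq
  (s -ˢ t) k = s k - t k

  _•_ : ℤ → Seq → Seq
  (c • s) k = c * s k

  mulLinear : ℤ → ℤ → Seq → Seq
  mulLinear c d s = c • s +ˢ d • x· s

  x·-zero : x· 0ˢ ≗ 0ˢ
  x·-zero zero    = refl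
  x·-zero (suc k) = refl

  x·-cong≗ : ∀ {s t} → s ≗ t → x· s ≗ x· t
  x·-cong≗ e zero    = refl
  x·-cong≗ e (suc k) = e k

  x·-• : ∀ c s → x· (c • s) ≗ c • x· s
  x·-• c s zero    = sym (*-zeroʳ c)
  x·-• c s (suc k) = refl

  x·-linear : ∀ c s t → x· (s +ˢ c • t) ≗ x· s +ˢ c • x· t
  x·-linear c s t zero    = sym (trans (+-identityˡ (c * 0ℤ)) (*-zeroʳ c))
  x·-linear c s t (suc k) = refl

  mulLinear-cong≗ : ∀ c d {s t} → s ≗ t → mulLinear c d s ≗ mulLinear c d t
  mulLinear-cong≗ c d e k = cong₂ (λ u v → c * u + d * v) (e k) (x·-cong≗ e k)

  mulLinear-by-1 : ∀ s → mulLinear 1ℤ 0ℤ s ≗ s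
  mulLinear-by-1 s k = trans (+-identityʳ (1ℤ * s k)) (*-identityˡ (s k))

  mulLinear-by-x : ∀ s → mulLinear 0ℤ 1ℤ s ≗ x· s
  mulLinear-by-x s k = trans (+-identityˡ (1ℤ * (x· s) k)) (*-identityˡ ((x· s) k))

  coeff-⊕ : ∀ p q → coeff (p ⊕ q) ≗ coeff p +ˢ coeff q
  coeff-⊕ []      q       k       = sym (+-identityˡ (coeff q k))
  coeff-⊕ (a ∷ p) []      k       = sym (+-identityʳ (coeff (a ∷ p) k))
  coeff-⊕ (a ∷ p) (b ∷ q) zero    = refl
  coeff-⊕ (a ∷ p) (b ∷ q) (suc k) = coeff-⊕ p q k

  coeff-scale : ∀ c p → coeff (scale c p) ≗ c • coeff p
  coeff-scale c []      k       = sym (*-zeroʳ c)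
  coeff-scale c (a ∷ p) zero    = refl
  coeff-scale c (a ∷ p) (suc k) = coeff-scale c p k

  coeff-0∷ : ∀ p → coeff (0ℤ ∷ p) ≗ x· coeff p
  coeff-0∷ p zero    = refl
  coeff-0∷ p (suc k) = refl

  coeff-∷-⊗ : ∀ a p q → coeff ((a ∷ p) ⊗ q) ≗ a • coeff q +ˢ x· coeff (p ⊗ q)
  coeff-∷-⊗ a p q k =
    trans (coeff-⊕ (scale a q) (0ℤ ∷ (p ⊗ q)) k) (cong₂ _+_ (coeff-scale a q k) (coeff-0∷ (p ⊗ q) k))

  coeff-constant-⊗ : ∀ c q → coeff ((c ∷ []) ⊗ q) ≗ c • coeff q
  coeff-constant-⊗ c q k =
    trans (coeff-∷-⊗ c [] q k)
          (trans (cong (_+_ (c * coeff q k)) (x·-zero k)) (+-identityʳ (c * coeff q k)))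

  coeff-linear-⊗ : ∀ c d q → coeff ((c ∷ d ∷ []) ⊗ q) ≗ mulLinear c d (coeff q)
  coeff-linear-⊗ c d q k =
    trans (coeff-∷-⊗ c (d ∷ []) q k)
          (cong (_+_ (c * coeff q k)) (trans (x·-cong≗ (coeff-constant-⊗ d q) k) (x·-• d (coeff q) k)))

  infix 4 _≈_[mod_]
  -- A record rather than a Π-type, so that s and t can be inferred from a proof.
  record _≈_[mod_] (s t : Seq) (m : ℤ) : Set where
    constructor coeffwise
    field at : ∀ k → m ∣ s k - t k
  open _≈_[mod_]

  module _ {m : ℤ} where

    ≗⇒≈ : ∀ {s t} → s ≗ t → s ≈ t [mod m ]
    ≗⇒≈ {t = t} e = coeffwise λ k → divides 0ℤ (trans (cong (_- t k) (e k)) (+-inverseʳ (t k)))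

    ≈-refl : ∀ {s} → s ≈ s [mod m ]
    ≈-refl = ≗⇒≈ λ _ → refl

    ≈-sym : ∀ {s t} → s ≈ t [mod m ] → t ≈ s [mod m ]
    ≈-sym {s} {t} e = coeffwise λ k → subst (m ∣_) (negate (s k) (t k)) (∣m⇒∣-m (at e k))
      where
      negate : ∀ a b → - (a - b) ≡ b - a
      negate = solve-∀

    ≈-trans : ∀ {s t u} → s ≈ t [mod m ] → t ≈ u [mod m ] → s ≈ u [mod m ]
    ≈-trans {s} {t} {u} e f = coeffwise λ k →
      subst (m ∣_) (telescope (s k) (t k) (u k)) (∣m∣n⇒∣m+n (at e k) (at f k))
      where
      telescope : ∀ a b c → (a - b) + (b - c) ≡ a - c
      telescope = solve-∀

    +ˢ-cong : ∀ {s s′ t t′} → s ≈ s′ [mod m ] → t ≈ t′ [mod m ] → s +ˢ t ≈ s′ +ˢ t′ [mod m ]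
    +ˢ-cong {s} {s′} {t} {t′} e f = coeffwise λ k →
      subst (m ∣_) (regroup (s k) (s′ k) (t k) (t′ k)) (∣m∣n⇒∣m+n (at e k) (at f k))
      where
      regroup : ∀ a a′ b b′ → (a - a′) + (b - b′) ≡ (a + b) - (a′ + b′)
      regroup = solve-∀

    -ˢ-cong : ∀ {s s′ t t′} → s ≈ s′ [mod m ] → t ≈ t′ [mod m ] → s -ˢ t ≈ s′ -ˢ t′ [mod m ]
    -ˢ-cong {s} {s′} {t} {t′} e f = coeffwise λ k →
      subst (m ∣_) (regroup (s k) (s′ k) (t k) (t′ k)) (∣m∣n⇒∣m-n (at e k) (at f k))
      where
      regroup : ∀ a a′ b b′ → (a - a′) - (b - b′) ≡ (a - b) - (a′ - b′)
      regroup = solve-∀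

    x·-cong : ∀ {s t} → s ≈ t [mod m ] → x· s ≈ x· t [mod m ]
    x·-cong e = coeffwise λ { zero → divides 0ℤ refl ; (suc k) → at e k }

    x·-≈0ˢ : ∀ {s} → s ≈ 0ˢ [mod m ] → x· s ≈ 0ˢ [mod m ]
    x·-≈0ˢ e = ≈-trans (x·-cong e) (≗⇒≈ x·-zero)

    mulLinear-cong : ∀ {c c′ d d′} s → m ∣ c - c′ → m ∣ d - d′ →
                     mulLinear c d s ≈ mulLinear c′ d′ s [mod m ]
    mulLinear-cong {c} {c′} {d} {d′} s e f = coeffwise λ k →
      subst (m ∣_) (regroup c c′ d d′ (s k) ((x· s) k))
            (∣m∣n⇒∣m+n (∣m⇒∣m*n (s k) e) (∣m⇒∣m*n ((x· s) k) f))
      where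
      regroup : ∀ c c′ d d′ a b → (c - c′) * a + (d - d′) * b ≡ (c * a + d * b) - (c′ * a + d′ * b)
      regroup = solve-∀

    +ˢ-multiple : ∀ {c s t} → m ∣ c → s +ˢ c • t ≈ s [mod m ]
    +ˢ-multiple {c} {s} {t} e = coeffwise λ k →
      subst (m ∣_) (cancel (s k) c (t k)) (∣m⇒∣m*n (t k) e)
      where
      cancel : ∀ a c b → c * b ≡ (a + c * b) - a
      cancel = solve-∀

  ≈-setoid : ℤ → Setoid 0ℓ 0ℓ
  ≈-setoid m = record
    { Carrier       = Seq
    ; _≈_           = λ s t → s ≈ t [mod m ]
    ; isEquivalence = record { refl = ≈-refl ; sym = ≈-sym ; trans = ≈-trans }
    }

  module _ (j : ℤ) where

    factor : ℕ → Seq → Seq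
    factor a = mulLinear (j - + a) (+ a)

    prod : ℕ → ℕ → Seq
    prod a zero    = coeff one
    prod a (suc n) = factor a (prod (suc a) n)

    coeff-prodFrom : ∀ a n → coeff (prodFrom (linFactor j) a n) ≗ prod a n
    coeff-prodFrom a zero    k = refl
    coeff-prodFrom a (suc n) k =
      trans (coeff-linear-⊗ (j - + a) (+ a) (prodFrom (linFactor j) (suc a) n) k)
            (mulLinear-cong≗ (j - + a) (+ a) (coeff-prodFrom (suc a) n) k)

    module _ (N : ℕ) where

      correction : ℕ → ℕ → Seq
      correction a zero    = 0ˢ
      correction a (suc n) = factor a D +ˢ (x· P -ˢ P) +ˢ + N • (x· D -ˢ D)
        where
        P D : Seq
        P = prod (suc a) n
        D = correction (suc a) n

      prod-shift : ∀ a n → prod (a ℕ.+ N) n ≗ prod a n +ˢ + N • correction a n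
      prod-shift a zero    k =
        sym (trans (cong (_+_ (coeff one k)) (*-zeroʳ (+ N))) (+-identityʳ (coeff one k)))
      prod-shift a (suc n) k = begin
          (j - + (a ℕ.+ N)) * P′ k + + (a ℕ.+ N) * (x· P′) k
        ≡⟨ cong₂ (λ u v → (j - + (a ℕ.+ N)) * u + + (a ℕ.+ N) * v)
                 (prod-shift (suc a) n k)
                 (trans (x·-cong≗ (prod-shift (suc a) n) k) (x·-linear (+ N) P D k)) ⟩
          (j - + (a ℕ.+ N)) * (P k + + N * D k) + + (a ℕ.+ N) * ((x· P) k + + N * (x· D) k)
        ≡⟨ cong (λ c → (j - c) * (P k + + N * D k) + c * ((x· P) k + + N * (x· D) k)) (pos-+ a N) ⟩
          (j - (+ a + + N)) * (P k + + N * D k) + (+ a + + N) * ((x· P) k + + N * (x· D) k)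
        ≡⟨ expand j (+ a) (+ N) (P k) ((x· P) k) (D k) ((x· D) k) ⟩
          prod a (suc n) k + + N * correction a (suc n) k
        ∎
        where
        open ≡-Reasoning
        P′ P D : Seq
        P′ = prod (suc a ℕ.+ N) n
        P  = prod (suc a) n
        D  = correction (suc a) n
        expand : ∀ j a N p xp d xd →
          (j - (a + N)) * (p + N * d) + (a + N) * (xp + N * xd)
            ≡ ((j - a) * p + a * xp) + N * (((j - a) * d + a * xd + (xp - p)) + N * (xd - d))
        expand = solve-∀

      prod-≈-shift : ∀ a n {m} → correction a n ≈ 0ˢ [mod m ] →
                     prod a n ≈ prod (a ℕ.+ N) n [mod + N * m ]
      prod-≈-shift a n {m} e = coeffwise λ k → subst (+ N * m ∣_)
          (sym (trans (cong (_-_ (prod a n k)) (prod-shift a n k))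
                      (cancel (prod a n k) (+ N) (correction a n k))))
          (∣m⇒∣-m (*-monoʳ-∣ (+ N) (subst (m ∣_) (+-identityʳ (correction a n k)) (at e k))))
        where
        cancel : ∀ p N d → p - (p + N * d) ≡ - (N * d)
        cancel = solve-∀

      prodFrom-≡-shift : ∀ a n {m} → correction a n ≈ 0ˢ [mod m ] →
        prodFrom (linFactor j) a n ≡ prodFrom (linFactor j) (a ℕ.+ N) n [modPoly + N * m ]
      prodFrom-≡-shift a n e k = ∣⇒∣ᵤ (subst (_ ∣_)
        (sym (cong₂ _-_ (coeff-prodFrom a n k) (coeff-prodFrom (a ℕ.+ N) n k)))
        (at (prod-≈-shift a n e) k))

    module _ (j-odd : Odd j) where

      2∣j-1 : + 2 ∣ j - 1ℤ
      2∣j-1 = let (k , j≡2k+1) = j-odd in divides k (trans (cong (_- 1ℤ) j≡2k+1) (halve k))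
        where
        halve : ∀ k → (+ 2 * k + 1ℤ) - 1ℤ ≡ k * + 2
        halve = solve-∀

      factor-even : ∀ {a} s → + 2 ∣ + a → factor a s ≈ s [mod + 2 ]
      factor-even {a} s a-even =
        ≈-trans (mulLinear-cong {c = j - + a} {1ℤ} {+ a} {0ℤ} s c≡1 d≡0) (≗⇒≈ (mulLinear-by-1 s))
        where
        reorder : ∀ j a → (j - 1ℤ) - a ≡ (j - a) - 1ℤ
        reorder = solve-∀
        c≡1 : + 2 ∣ (j - + a) - 1ℤ
        c≡1 = subst (+ 2 ∣_) (reorder j (+ a)) (∣m∣n⇒∣m-n 2∣j-1 a-even)
        d≡0 : + 2 ∣ + a - 0ℤ
        d≡0 = subst (+ 2 ∣_) (sym (+-identityʳ (+ a))) a-even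

      factor-odd : ∀ {a} s → + 2 ∣ + a → factor (suc a) s ≈ x· s [mod + 2 ]
      factor-odd {a} s a-even =
        ≈-trans (mulLinear-cong {c = j - + suc a} {0ℤ} {+ suc a} {1ℤ} s c≡0 d≡1) (≗⇒≈ (mulLinear-by-x s))
        where
        reorder : ∀ j a → (j - 1ℤ) - a ≡ (j - (1ℤ + a)) - 0ℤ
        reorder = solve-∀
        predecessor : ∀ a → a ≡ (1ℤ + a) - 1ℤ
        predecessor = solve-∀
        c≡0 : + 2 ∣ (j - + suc a) - 0ℤ
        c≡0 = subst (+ 2 ∣_) (reorder j (+ a)) (∣m∣n⇒∣m-n 2∣j-1 a-even)
        d≡1 : + 2 ∣ + suc a - 1ℤ
        d≡1 = subst (+ 2 ∣_) (predecessor (+ a)) a-even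

      2∣2+ : ∀ {a} → + 2 ∣ + a → + 2 ∣ + (2 ℕ.+ a)
      2∣2+ = ∣m∣n⇒∣m+n ∣-refl

      prod-two-steps : ∀ {a} n → + 2 ∣ + a → prod a (2 ℕ.+ n) ≈ x· prod (2 ℕ.+ a) n [mod + 2 ]
      prod-two-steps n a-even = ≈-trans (factor-even _ a-even) (factor-odd _ a-even)

      module _ {N : ℕ} (N-even : + 2 ∣ + N) where
        open import Relation.Binary.Reasoning.Setoid (≈-setoid (+ 2))

        correction-suc-mod2 : ∀ a n →
          correction N a (suc n)
            ≈ factor a (correction N (suc a) n) +ˢ (x· prod (suc a) n -ˢ prod (suc a) n) [mod + 2 ]
        correction-suc-mod2 a n = +ˢ-multiple N-even

        correction-two-steps : ∀ {a} n → + 2 ∣ + a →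
          correction N a (2 ℕ.+ n)
            ≈ x· correction N (2 ℕ.+ a) n +ˢ (x· x· prod (2 ℕ.+ a) n -ˢ prod (2 ℕ.+ a) n) [mod + 2 ]
        correction-two-steps {a} n a-even = begin
            correction N a (2 ℕ.+ n)
          ≈⟨ correction-suc-mod2 a (suc n) ⟩
            factor a D₁ +ˢ (x· P₁ -ˢ P₁)
          ≈⟨ +ˢ-cong (factor-even D₁ a-even)
                     (-ˢ-cong (x·-cong (factor-odd P a-even)) (factor-odd P a-even)) ⟩
            D₁ +ˢ (x· x· P -ˢ x· P)
          ≈⟨ +ˢ-cong (≈-trans (correction-suc-mod2 (suc a) n) (+ˢ-cong (factor-odd D a-even) ≈-refl))
                     ≈-refl ⟩
            x· D +ˢ (x· P -ˢ P) +ˢ (x· x· P -ˢ x· P)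
          ≈⟨ ≗⇒≈ (λ k → telescope ((x· D) k) ((x· P) k) (P k) ((x· x· P) k)) ⟩
            x· D +ˢ (x· x· P -ˢ P)
          ∎
          where
          P D P₁ D₁ : Seq
          P  = prod (2 ℕ.+ a) n
          D  = correction N (2 ℕ.+ a) n
          P₁ = prod (suc a) (suc n)
          D₁ = correction N (suc a) (suc n)
          telescope : ∀ d xp p xxp → d + (xp - p) + (xxp - xp) ≡ d + (xxp - p)
          telescope = solve-∀

        correction-four-steps : ∀ {a} n → + 2 ∣ + a →
          correction N a (4 ℕ.+ n) ≈ x· x· correction N (4 ℕ.+ a) n [mod + 2 ]
        correction-four-steps {a} n a-even = begin
            correction N a (4 ℕ.+ n)
          ≈⟨ correction-two-steps (2 ℕ.+ n) a-even ⟩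
            x· correction N (2 ℕ.+ a) (2 ℕ.+ n) +ˢ (x· x· P₂ -ˢ P₂)
          ≈⟨ +ˢ-cong (x·-cong (correction-two-steps n a+2-even))
                     (-ˢ-cong (x·-cong (x·-cong (prod-two-steps n a+2-even))) (prod-two-steps n a+2-even)) ⟩
            x· (x· D +ˢ (x· x· P -ˢ P)) +ˢ (x· x· x· P -ˢ x· P)
          ≈⟨ ≗⇒≈ regroup ⟩
            x· x· D +ˢ + 2 • (x· x· x· P -ˢ x· P)
          ≈⟨ +ˢ-multiple ∣-refl ⟩
            x· x· D
          ∎
          where
          a+2-even : + 2 ∣ + (2 ℕ.+ a)
          a+2-even = 2∣2+ a-even
          P D P₂ : Seq
          P  = prod (4 ℕ.+ a) n
          D  = correction N (4 ℕ.+ a) n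
          P₂ = prod (2 ℕ.+ a) (2 ℕ.+ n)
          double : ∀ d p q → d + (p - q) + (p - q) ≡ d + + 2 * (p - q)
          double = solve-∀
          regroup : x· (x· D +ˢ (x· x· P -ˢ P)) +ˢ (x· x· x· P -ˢ x· P)
                  ≗ x· x· D +ˢ + 2 • (x· x· x· P -ˢ x· P)
          regroup zero    = refl
          regroup (suc k) = double ((x· D) k) ((x· x· P) k) (P k)

        correction-vanishes : ∀ {a} u → + 2 ∣ + a → correction N a (u ℕ.* 4) ≈ 0ˢ [mod + 2 ]
        correction-vanishes zero    a-even = ≈-refl
        correction-vanishes {a} (suc u) a-even = begin
            correction N a (4 ℕ.+ u ℕ.* 4)
          ≈⟨ correction-four-steps (u ℕ.* 4) a-even ⟩
            x· x· correction N (4 ℕ.+ a) (u ℕ.* 4)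
          ≈⟨ x·-≈0ˢ (x·-≈0ˢ (correction-vanishes u (2∣2+ (2∣2+ a-even)))) ⟩
            0ˢ
          ∎

      correction-2^-vanishes : ∀ q → 2 ℕ.≤ q → correction (2 ℕ.^ q) 0 (2 ℕ.^ q) ≈ 0ˢ [mod + 2 ]
      correction-2^-vanishes (suc (suc q)) (ℕ.s≤s (ℕ.s≤s ℕ.z≤n)) =
        subst (λ n → correction (2 ℕ.^ (2 ℕ.+ q)) 0 n ≈ 0ˢ [mod + 2 ]) 2^q*4≡2^[2+q]
              (correction-vanishes (∣ᵤ⇒∣ (m∣m*n (2 ℕ.^ suc q))) (2 ℕ.^ q) (divides 0ℤ refl))
        where
        2^q*4≡2^[2+q] : 2 ℕ.^ q ℕ.* 4 ≡ 2 ℕ.^ (2 ℕ.+ q)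
        2^q*4≡2^[2+q] = trans (*-comm (2 ℕ.^ q) 4) (*-assoc 2 2 (2 ℕ.^ q))

  2^q*2≡2^[q+1] : ∀ q → + (2 ℕ.^ q) * + 2 ≡ + (2 ℕ.^ (q ℕ.+ 1))
  2^q*2≡2^[q+1] q = sym (trans (cong +_ (^-distribˡ-+-* 2 q 1)) (pos-* (2 ℕ.^ q) 2))

open import Data.Nat using (ℕ; _≤_; _^_; _+_)
open import Data.Integer using (ℤ; +_)
open import Relation.Binary.PropositionalEquality using (subst)

mainTheorem13 : (j : ℤ) → Odd j → (q : ℕ) → 2 ≤ q →
    prodFrom (linFactor j) 0 (2 ^ q) ≡ prodFrom (linFactor j) (2 ^ q) (2 ^ q) [modPoly (+ (2 ^ (q + 1))) ]
mainTheorem13 j j-odd q 2≤q =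
  subst (λ m → prodFrom (linFactor j) 0 (2 ^ q) ≡ prodFrom (linFactor j) (2 ^ q) (2 ^ q) [modPoly m ])
        (2^q*2≡2^[q+1] q)
        (prodFrom-≡-shift j (2 ^ q) 0 (2 ^ q) (correction-2^-vanishes j j-odd q 2≤q))
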